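{- Let $G=(\Sigma,I,L,\rightarrow)$ be a transition system with $\Sigma$ finite. Let $R_i$ be a preorder on $\Sigma$, and let $\sigma_i$ be finite with $I\subseteq\sigma_i\subseteq\mathrm{post}^*(I)$. Let $\langle R,\sigma\rangle$ be the output of Algorithm 5 (described in the context) on input $G,R_i,\sigma_i$. Let $R_{\mathrm{sim}}$ and $P_{\mathrm{sim}}$ be, respectively, the simulation preorder and simulation partition of $G$ w.r.t. $R_i$. Let $P=\{\{y\in\Sigma\mid R(y)=R(x)\}\mid x\in\Sigma\}$. Then: \[\{R_{\mathrm{sim}}(x)\mid x\in\mathrm{post}^*(I)\}=\{R(x)\mid x\in\sigma\},\] \[\{B\cap\mathrm{post}^*(I)\mid B\in P_{\mathrm{sim}}^{\mathrm{post}^*(I)}\}=\{B\cap\mathrm{post}^*(I)\mid B\in P^{\sigma}\},\] \[P_{\mathrm{sim}}^{\mathrm{post}^*(I)}=\{P_{\mathrm{sim}}(B)\mid B\in P^{\sigma}\}.\]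
   Context: Transition system, operators and simulation. - $G=(\Sigma,I,L,\rightarrow)$ has states $\Sigma$, initial states $I$, finite label set $L$, and transitions $x\xrightarrow{a}y$. - $\mathrm{pre}_a(Y)=\{x\mid\exists y\in Y.\ x\xrightarrow{a}y\}$. - $\mathrm{post}(X)=\{y\mid\exists x\in X,a.\ x\xrightarrow{a}y\}$ and $\mathrm{post}^*(X)=\bigcup_n\mathrm{post}^n(X)$. - A relation $R\subseteq\Sigma\times\Sigma$ is a simulation w.r.t. a preorder $R_i$ if $R\subseteq R_i$ and, whenever $(s,t)\in R$ and $s\xrightarrow{a}s'$, there is $t'$ with $t\xrightarrow{a}t'$ and $(s',t')\in R$. - $R_{\mathrm{sim}}$ is the greatest simulation, and $P_{\mathrm{sim}}$ is the partition induced by $R_{\mathrm{sim}}\cap R_{\mathrm{sim}}^{ -1}$. Notation for relations and partitions. - $R(x)=\{y\mid (x,y)\in R\}$. - For a partition $P$: $P^S=\{B\in P\mid B\cap S\neq\varnothing\}$, $P(x)$ is the block containing $x$, and $P(S)=\bigcup_{x\in S}P(x)$. Refined subroutine $\mathrm{Ref}(R,\sigma)$. While there is $\langle a,x,x'\rangle$ with $R(x)\cap\sigma\neq\varnothing$, $x\xrightarrow{a}x'$ and $R(x)\not\subseteq\mathrm{pre}_a(R(x'))$, choose one and set $R(x):=R(x)\cap\mathrm{pre}_a(R(x'))$. When no such triple exists, return $\langle R,\sigma\rangle$. Algorithm 5. Initially $R:=R_i$, $\sigma:=\sigma_i$ and $U_{bad}:=\varnothing$. The algorithm repeats the following forever.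 - Compute \[U=\{x\in\Sigma\mid \neg\exists s\in\sigma.\ R(x)=R(s),\ R(x)\cap\mathrm{post}(\sigma)\neq\varnothing\}\] and \[V=\{\langle a,x,x'\rangle\mid\exists s\in\sigma.\ R(x)=R(s),\ x\xrightarrow{a}x',\ R(x)\not\subseteq\mathrm{pre}_a(R(x'))\}.\] - Then nondeterministically execute one enabled guarded command: - (Search) if $U\setminus U_{bad}\neq\varnothing$: choose $x\in U\setminus U_{bad}$ and let $S:=(R(x)\cap\mathrm{post}(\sigma))\setminus\sigma$. - If $S\neq\varnothing$: choose $s\in S$, set $\sigma:=\sigma\cup\{s\}$ and $U_{bad}:=\varnothing$. - Otherwise: set $U_{bad}:=U_{bad}\cup\{x\}$. - (Refine) if $V\neq\varnothing$: choose $\langle a,x,x'\rangle\in V$, set $R(x):=R(x)\cap\mathrm{pre}_a(R(x'))$ and $U_{bad}:=\varnothing$. - (Expand) if $U=U_{bad}\neq\varnothing$ and $V=\varnothing$: - If $\mathrm{post}(\sigma)\subseteq\sigma$: return $\mathrm{Ref}(R,\sigma)$. - Otherwise: set $\sigma:=\sigma\cup\mathrm{post}(\sigma)$ and $U_{bad}:=\varnothing$. - if $U=\varnothing$ and $V=\varnothing$: return $\langle R,\sigma\rangle$. -}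

module Defs where

open import Data.Nat using (ℕ)
open import Data.Fin using (Fin)
open import Data.Fin.Properties using (_≟_; any?)
open import Data.Fin.Subset
open import Data.Fin.Subset.Properties using (_∈?_; nonempty?)
open import Data.Vec using (tabulate)
open import Data.Bool using (if_then_else_)
import Data.Bool as Bool
open import Data.Vec.Properties using (≡-dec)
open import Data.Product using (Σ; ∃; _×_; _,_)
open import Relation.Nullary using (¬_; ⌊_⌋)
open import Relation.Nullary.Decidable using (_×-dec_)
open import Relation.Binary.PropositionalEquality using (_≡_)
open import Function.Bundles using (_⇔_)

-- A transition system with finite state set Σ = Fin n and finite label
-- set L = Fin m.  x —a→ y  iff  y ∈ δ a x.  A relation R ⊆ Σ × Σ is represented by its images
-- R : Fin n → Subset n, with (x , y) ∈ R iff y ∈ R x, i.e. R(x) = R x.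

Rel : ℕ → Set
Rel n = Fin n → Subset n

_[_]≔_ : ∀ {n} → Rel n → Fin n → Subset n → Rel n
(R [ x ]≔ S) y = if ⌊ y ≟ x ⌋ then S else R y

IsPreorder : ∀ {n} → Rel n → Set
IsPreorder {n} Ri = (∀ (x : Fin n) → x ∈ Ri x)
                  × (∀ (x y z : Fin n) → y ∈ Ri x → z ∈ Ri y → z ∈ Ri x)

Fam : ℕ → Set₁
Fam n = Subset n → Set

_≐_ : ∀ {n} → Fam n → Fam n → Set
_≐_ {n} F G = ∀ (B : Subset n) → F B ⇔ G B

-- for a partition given by its block function  blk : Fin n → Subset n
-- (blk x = the block containing x):  the blocks of the partition,
-- and P^S = { B ∈ P | B ∩ S ≠ ∅ }
Blocks : ∀ {n} → Rel n → Fam n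
Blocks {n} blk B = ∃ λ (x : Fin n) → B ≡ blk x

Meeting : ∀ {n} → Rel n → Subset n → Fam n
Meeting blk S B = Blocks blk B × Nonempty (B ∩ S)

blocksOf : ∀ {n} → Rel n → Subset n → Subset n
blocksOf blk S = tabulate λ y → ⌊ any? (λ x → (x ∈? S) ×-dec (y ∈? blk x)) ⌋

module TS {n m : ℕ} (δ : Fin m → Fin n → Subset n) where

  pre : Fin m → Subset n → Subset n
  pre a Y = tabulate λ x → ⌊ nonempty? (δ a x ∩ Y) ⌋

  post : Subset n → Subset n
  post X = tabulate λ y → ⌊ any? (λ x → any? (λ a → (x ∈? X) ×-dec (y ∈? δ a x))) ⌋

  postN : ℕ → Subset n → Subset n
  postN ℕ.zero X = X
  postN (ℕ.suc k) X = post (postN k X)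

  IsPostStar : Subset n → Subset n → Set
  IsPostStar X P = ∀ (y : Fin n) → (y ∈ P ⇔ ∃ λ (k : ℕ) → y ∈ postN k X)

  IsSimulation : Rel n → Rel n → Set
  IsSimulation Ri S =
      (∀ (s t : Fin n) → t ∈ S s → t ∈ Ri s)
    × (∀ (s t s' : Fin n) (a : Fin m) → t ∈ S s → s' ∈ δ a s →
         ∃ λ (t' : Fin n) → t' ∈ δ a t × t' ∈ S s')

  IsGreatestSimulation : Rel n → Rel n → Set
  IsGreatestSimulation Ri Rsim =
      IsSimulation Ri Rsim
    × (∀ (S : Rel n) → IsSimulation Ri S → ∀ (x : Fin n) → S x ⊆ Rsim x)

  eqBlock : Rel n → Rel n
  eqBlock R x = tabulate λ y → ⌊ (y ∈? R x) ×-dec (x ∈? R y) ⌋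

  sameImage : Rel n → Rel n
  sameImage R x = tabulate λ y → ⌊ ≡-dec Bool._≟_ (R y) (R x) ⌋

  RefEnabled : Rel n → Subset n → Fin m → Fin n → Fin n → Set
  RefEnabled R σ a x x' =
    Nonempty (R x ∩ σ) × x' ∈ δ a x × ¬ (R x ⊆ pre a (R x'))

  -- RefOut R σ R' : some run of Ref(R, σ) returns ⟨R', σ⟩
  data RefOut (R : Rel n) (σ : Subset n) : Rel n → Set where
    ref-done : (∀ a x x' → ¬ RefEnabled R σ a x x') → RefOut R σ R
    ref-step : ∀ {R'} a x x' → RefEnabled R σ a x x' →
               RefOut (R [ x ]≔ (R x ∩ pre a (R x'))) σ R' → RefOut R σ R'

  InU : Rel n → Subset n → Fin n → Set
  InU R σ x = (¬ ∃ λ s → s ∈ σ × R x ≡ R s) × Nonempty (R x ∩ post σ)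

  InV : Rel n → Subset n → Fin m → Fin n → Fin n → Set
  InV R σ a x x' =
    (∃ λ s → s ∈ σ × R x ≡ R s) × x' ∈ δ a x × ¬ (R x ⊆ pre a (R x'))

  VEmpty : Rel n → Subset n → Set
  VEmpty R σ = ∀ a x x' → ¬ InV R σ a x x'

  UeqUbadNonempty : Rel n → Subset n → Subset n → Set
  UeqUbadNonempty R σ Ubad =
    (∀ x → (InU R σ x ⇔ x ∈ Ubad)) × (∃ λ x → InU R σ x)

  -- Run R σ Ubad R' σ' : from the state (R, σ, U_bad), some (nondeterministic)
  -- run of the main loop of Algorithm 5 returns ⟨R', σ'⟩.
  data Run : Rel n → Subset n → Subset n → Rel n → Subset n → Set where
    search-add : ∀ {R σ Ubad R' σ'} x s →
      InU R σ x → x ∉ Ubad →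
      s ∈ R x → s ∈ post σ → s ∉ σ →
      Run R (σ ∪ ⁅ s ⁆) ⊥ R' σ' → Run R σ Ubad R' σ'
    search-bad : ∀ {R σ Ubad R' σ'} x →
      InU R σ x → x ∉ Ubad →
      Empty ((R x ∩ post σ) ─ σ) →
      Run R σ (Ubad ∪ ⁅ x ⁆) R' σ' → Run R σ Ubad R' σ'
    refine : ∀ {R σ Ubad R' σ'} a x x' →
      InV R σ a x x' →
      Run (R [ x ]≔ (R x ∩ pre a (R x'))) σ ⊥ R' σ' → Run R σ Ubad R' σ'
    expand-return : ∀ {R σ Ubad R'} →
      UeqUbadNonempty R σ Ubad → VEmpty R σ →
      post σ ⊆ σ → RefOut R σ R' → Run R σ Ubad R' σ
    expand : ∀ {R σ Ubad R' σ'} →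
      UeqUbadNonempty R σ Ubad → VEmpty R σ →
      ¬ (post σ ⊆ σ) →
      Run R (σ ∪ post σ) ⊥ R' σ' → Run R σ Ubad R' σ'
    return : ∀ {R σ Ubad} →
      (∀ x → ¬ InU R σ x) → VEmpty R σ → Run R σ Ubad R σ

-- Every step of Algorithm 5 keeps  Rsim ⊆ R ⊆ Ri  (a refinement only removes
-- pairs that no simulation can contain) and  I ⊆ σ ⊆ post*(I).  When the
-- algorithm stops, the set K of states x with R(x) = R(s) for some s ∈ σ (or,
-- after Ref, with R(x) ∩ σ ≠ ∅) contains I, is closed under transitions, and R
-- is stable on K; taking R on K and Rsim elsewhere therefore gives a simulation,
-- so R = Rsim on K.  Every reachable state lies in K, hence the images R(s),
-- s ∈ σ, are exactly the Rsim-images of reachable states, and all three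
-- equalities follow because P and Psim are the kernels of R and Rsim.
module Submission where

open import Defs
open import Data.Nat using (ℕ)
open import Data.Fin using (Fin)
open import Data.Fin.Subset using (Subset; _∈_; _⊆_; _∩_; _∪_; ⁅_⁆; ⊥; Nonempty)
open import Data.Fin.Subset.Properties
  using (_∈?_; _⊆?_; nonempty?; ⊆-antisym; x∈p∩q⁺; x∈p∩q⁻; x∈p∪q⁻; p⊆p∪q; x∈⁅x⁆; x∈⁅y⁆⇒x≡y)
open import Data.Fin.Properties using (_≟_; any?)
open import Data.Vec using (tabulate)
open import Data.Vec.Properties using (lookup∘tabulate; []=⇒lookup; lookup⇒[]=; ≡-dec)
import Data.Bool as Bool
open import Data.Bool using (if_then_else_)
open import Data.Bool.Properties using (T-≡)
open import Data.Product using (∃; _×_; _,_; proj₁; proj₂)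
open import Data.Sum using (_⊎_; inj₁; inj₂; [_,_])
open import Relation.Nullary using (¬_; Dec; yes; no; ⌊_⌋; contradiction)
open import Relation.Nullary.Decidable using (_×-dec_; isYes≗does; dec-true; toWitness; decidable-stable)
open import Relation.Binary.PropositionalEquality
  using (_≡_; refl; sym; trans; cong; subst; module ≡-Reasoning)
open import Function.Bundles using (Equivalence; mk⇔)

∈-tabulate⁺ : ∀ {k} {P : Fin k → Set} (P? : ∀ y → Dec (P y)) {x : Fin k} →
              P x → x ∈ tabulate (λ y → ⌊ P? y ⌋)
∈-tabulate⁺ P? {x} px =
  lookup⇒[]= x _ (trans (lookup∘tabulate _ x) (trans (isYes≗does (P? x)) (dec-true (P? x) px)))

∈-tabulate⁻ : ∀ {k} {P : Fin k → Set} (P? : ∀ y → Dec (P y)) {x : Fin k} →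
              x ∈ tabulate (λ y → ⌊ P? y ⌋) → P x
∈-tabulate⁻ P? {x} x∈ =
  toWitness {a? = P? x} (Equivalence.from T-≡ (trans (sym (lookup∘tabulate _ x)) ([]=⇒lookup x∈)))

∈-if⁺ : ∀ {k} {P : Set} (P? : Dec P) {A B : Subset k} {z : Fin k} →
        (P → z ∈ A) → (¬ P → z ∈ B) → z ∈ (if ⌊ P? ⌋ then A else B)
∈-if⁺ (yes p) z∈A z∈B = z∈A p
∈-if⁺ (no ¬p) z∈A z∈B = z∈B ¬p

∈-if⁻ : ∀ {k} {P : Set} (P? : Dec P) {A B : Subset k} {z : Fin k} →
        z ∈ (if ⌊ P? ⌋ then A else B) → (P × z ∈ A) ⊎ z ∈ B
∈-if⁻ (yes p) z∈A = inj₁ (p , z∈A)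
∈-if⁻ (no _)  z∈B = inj₂ z∈B

module TransitionSystem {n m : ℕ} (δ : Fin m → Fin n → Subset n) where
  open TS δ

  Closed : (Fin n → Set) → Set
  Closed K = ∀ {x a x'} → K x → x' ∈ δ a x → K x'

  Stable : Rel n → (Fin n → Set) → Set
  Stable R K = ∀ {x a x'} → K x → x' ∈ δ a x → R x ⊆ pre a (R x')

  ∈-post⁺ : ∀ {X x y a} → x ∈ X → y ∈ δ a x → y ∈ post X
  ∈-post⁺ {X} {x} {y} {a} x∈X y∈δ =
    ∈-tabulate⁺ (λ y → any? (λ x → any? (λ a → (x ∈? X) ×-dec (y ∈? δ a x)))) (x , a , x∈X , y∈δ)

  ∈-post⁻ : ∀ {X y} → y ∈ post X → ∃ λ x → ∃ λ a → x ∈ X × y ∈ δ a x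
  ∈-post⁻ {X} = ∈-tabulate⁻ (λ y → any? (λ x → any? (λ a → (x ∈? X) ×-dec (y ∈? δ a x))))

  ∈-pre⁺ : ∀ {a Y x y} → y ∈ δ a x → y ∈ Y → x ∈ pre a Y
  ∈-pre⁺ {a} {Y} {x} {y} y∈δ y∈Y =
    ∈-tabulate⁺ (λ x → any? (λ y → y ∈? (δ a x ∩ Y))) (y , x∈p∩q⁺ (y∈δ , y∈Y))

  ∈-pre⁻ : ∀ {a Y x} → x ∈ pre a Y → ∃ λ y → y ∈ δ a x × y ∈ Y
  ∈-pre⁻ {a} {Y} {x} x∈pre with ∈-tabulate⁻ (λ x → any? (λ y → y ∈? (δ a x ∩ Y))) x∈pre
  ... | y , y∈ = y , x∈p∩q⁻ (δ a x) Y y∈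

  ∈-sameImage⁺ : ∀ {R : Rel n} {x z} → R z ≡ R x → z ∈ sameImage R x
  ∈-sameImage⁺ {R} {x} = ∈-tabulate⁺ (λ y → ≡-dec Bool._≟_ (R y) (R x))

  ∈-sameImage⁻ : ∀ {R : Rel n} {x z} → z ∈ sameImage R x → R z ≡ R x
  ∈-sameImage⁻ {R} {x} = ∈-tabulate⁻ (λ y → ≡-dec Bool._≟_ (R y) (R x))

  sameImage-cong : ∀ {R : Rel n} {x y} → R x ≡ R y → sameImage R x ≡ sameImage R y
  sameImage-cong eq =
    ⊆-antisym (λ w∈ → ∈-sameImage⁺ (trans (∈-sameImage⁻ w∈) eq))
              (λ w∈ → ∈-sameImage⁺ (trans (∈-sameImage⁻ w∈) (sym eq)))

  sameImage-at-member : ∀ {R : Rel n} {B x z} → B ≡ sameImage R x → z ∈ B → B ≡ sameImage R z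
  sameImage-at-member B≡ z∈B = trans B≡ (sameImage-cong (sym (∈-sameImage⁻ (subst (_ ∈_) B≡ z∈B))))

  sameImage-∩-agree : ∀ {R R' : Rel n} {S : Subset n} → (∀ {y} → y ∈ S → R y ≡ R' y) →
                      ∀ {z} → z ∈ S → sameImage R z ∩ S ≡ sameImage R' z ∩ S
  sameImage-∩-agree {S = S} agree z∈S =
    ⊆-antisym (transfer agree z∈S) (transfer (λ y∈S → sym (agree y∈S)) z∈S)
    where
    transfer : ∀ {A B : Rel n} → (∀ {y} → y ∈ S → A y ≡ B y) → ∀ {z} → z ∈ S →
               sameImage A z ∩ S ⊆ sameImage B z ∩ S
    transfer {A} {B} f {z} z∈S w∈ with x∈p∩q⁻ (sameImage A z) S w∈
    ... | w∈A , w∈S = x∈p∩q⁺ (∈-sameImage⁺ (trans (sym (f w∈S)) (trans (∈-sameImage⁻ w∈A) (f z∈S))) , w∈S)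

  eqBlock≡sameImage : ∀ {R : Rel n} → (∀ x → x ∈ R x) →
                      (∀ {x y z} → y ∈ R x → z ∈ R y → z ∈ R x) →
                      ∀ x → eqBlock R x ≡ sameImage R x
  eqBlock≡sameImage {R} refl-R trans-R x = ⊆-antisym to from
    where
    to : eqBlock R x ⊆ sameImage R x
    to z∈ with ∈-tabulate⁻ (λ y → (y ∈? R x) ×-dec (x ∈? R y)) z∈
    ... | z∈Rx , x∈Rz = ∈-sameImage⁺ (⊆-antisym (trans-R z∈Rx) (trans-R x∈Rz))
    from : sameImage R x ⊆ eqBlock R x
    from {z} z∈ = ∈-tabulate⁺ (λ y → (y ∈? R x) ×-dec (x ∈? R y))
      (subst (z ∈_) eq (refl-R z) , subst (x ∈_) (sym eq) (refl-R x))
      where eq = ∈-sameImage⁻ z∈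

module GreatestSimulation {n m : ℕ} (δ : Fin m → Fin n → Subset n) (Ri Rsim : Rel n)
  (Ri-preorder : IsPreorder Ri) (greatest : TS.IsGreatestSimulation δ Ri Rsim) where
  open TS δ
  open TransitionSystem δ

  Rsim⊆Ri : ∀ s t → t ∈ Rsim s → t ∈ Ri s
  Rsim⊆Ri = proj₁ (proj₁ greatest)

  private
    Rsim-simulates : ∀ s t s' a → t ∈ Rsim s → s' ∈ δ a s → ∃ λ t' → t' ∈ δ a t × t' ∈ Rsim s'
    Rsim-simulates = proj₂ (proj₁ greatest)

    Rsim-greatest : ∀ S → IsSimulation Ri S → ∀ x → S x ⊆ Rsim x
    Rsim-greatest = proj₂ greatest

  Rsim-refl : ∀ x → x ∈ Rsim x
  Rsim-refl x = Rsim-greatest (λ y → ⁅ y ⁆) (id⊆Ri , id-simulates) x (x∈⁅x⁆ x)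
    where
    id⊆Ri : ∀ s t → t ∈ ⁅ s ⁆ → t ∈ Ri s
    id⊆Ri s t t∈ with x∈⁅y⁆⇒x≡y s t∈
    ... | refl = proj₁ Ri-preorder t
    id-simulates : ∀ s t s' a → t ∈ ⁅ s ⁆ → s' ∈ δ a s → ∃ λ t' → t' ∈ δ a t × t' ∈ ⁅ s' ⁆
    id-simulates s t s' a t∈ s⟶s' with x∈⁅y⁆⇒x≡y s t∈
    ... | refl = s' , s⟶s' , x∈⁅x⁆ s'

  Rsim-trans : ∀ {x y z} → y ∈ Rsim x → z ∈ Rsim y → z ∈ Rsim x
  Rsim-trans {x} y∈ z∈ = Rsim-greatest Rsim² (Rsim²⊆Ri , Rsim²-simulates) x (∈-Rsim² (_ , y∈ , z∈))
    where
    via : ∀ x z → Dec (∃ λ y → y ∈ Rsim x × z ∈ Rsim y)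
    via x z = any? (λ y → (y ∈? Rsim x) ×-dec (z ∈? Rsim y))
    Rsim² : Rel n
    Rsim² x = tabulate λ z → ⌊ via x z ⌋
    ∈-Rsim² : ∀ {x z} → (∃ λ y → y ∈ Rsim x × z ∈ Rsim y) → z ∈ Rsim² x
    ∈-Rsim² {x} = ∈-tabulate⁺ (via x)
    Rsim²⊆Ri : ∀ s t → t ∈ Rsim² s → t ∈ Ri s
    Rsim²⊆Ri s t t∈ with ∈-tabulate⁻ (via s) t∈
    ... | y , y∈ , t∈' = proj₂ Ri-preorder s y t (Rsim⊆Ri s y y∈) (Rsim⊆Ri y t t∈')
    Rsim²-simulates : ∀ s t s' a → t ∈ Rsim² s → s' ∈ δ a s → ∃ λ t' → t' ∈ δ a t × t' ∈ Rsim² s'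
    Rsim²-simulates s t s' a t∈ s⟶s' with ∈-tabulate⁻ (via s) t∈
    ... | y , y∈ , t∈' with Rsim-simulates s y s' a y∈ s⟶s'
    ... | y' , y⟶y' , y'∈ with Rsim-simulates y t y' a t∈' y⟶y'
    ... | t' , t⟶t' , t'∈ = t' , t⟶t' , ∈-Rsim² (y' , y'∈ , t'∈)

  -- R on K and Rsim off K is a simulation: closedness of K keeps a move from K
  -- inside the R-part, where stability provides the matching move.
  stable-closed⇒⊆Rsim : ∀ (R : Rel n) (K : Fin n → Set) (K? : ∀ x → Dec (K x)) →
    (∀ x → Rsim x ⊆ R x) → (∀ x → R x ⊆ Ri x) → Stable R K → Closed K →
    ∀ {x} → K x → R x ⊆ Rsim x
  stable-closed⇒⊆Rsim R K K? Rsim⊆R R⊆Ri stable closed {x} Kx z∈Rx =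
    Rsim-greatest S (S⊆Ri , S-simulates) x (∈-if⁺ (K? x) (λ _ → z∈Rx) (contradiction Kx))
    where
    S : Rel n
    S y = if ⌊ K? y ⌋ then R y else Rsim y
    S⊆Ri : ∀ s t → t ∈ S s → t ∈ Ri s
    S⊆Ri s t t∈ = [ (λ { (_ , t∈R) → R⊆Ri s t∈R }) , Rsim⊆Ri s t ] (∈-if⁻ (K? s) t∈)
    S-simulates : ∀ s t s' a → t ∈ S s → s' ∈ δ a s → ∃ λ t' → t' ∈ δ a t × t' ∈ S s'
    S-simulates s t s' a t∈ s⟶s' with ∈-if⁻ (K? s) t∈
    ... | inj₁ (Ks , t∈R) with ∈-pre⁻ (stable Ks s⟶s' t∈R)
    ...   | t' , t⟶t' , t'∈R = t' , t⟶t' , ∈-if⁺ (K? s') (λ _ → t'∈R) (contradiction (closed Ks s⟶s'))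
    S-simulates s t s' a t∈ s⟶s' | inj₂ t∈Rsim with Rsim-simulates s t s' a t∈Rsim s⟶s'
    ... | t' , t⟶t' , t'∈ = t' , t⟶t' , ∈-if⁺ (K? s') (λ _ → Rsim⊆R s' t'∈) (λ _ → t'∈)

  Rsim⊆-refine : ∀ {R : Rel n} {a x x'} → x' ∈ δ a x → (∀ y → Rsim y ⊆ R y) →
                 ∀ y → Rsim y ⊆ (R [ x ]≔ (R x ∩ pre a (R x'))) y
  Rsim⊆-refine {R} {a} {x} {x'} x⟶x' Rsim⊆R y {z} z∈ =
    ∈-if⁺ (y ≟ x) (λ { refl → refined z∈ }) (λ _ → Rsim⊆R y z∈)
    where
    refined : ∀ {z} → z ∈ Rsim x → z ∈ R x ∩ pre a (R x')
    refined z∈ with Rsim-simulates x _ x' a z∈ x⟶x'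
    ... | z' , z⟶z' , z'∈ = x∈p∩q⁺ (Rsim⊆R x z∈ , ∈-pre⁺ z⟶z' (Rsim⊆R x' z'∈))


module Reachability {n m : ℕ} (δ : Fin m → Fin n → Subset n) (I Reach : Subset n)
  (reach : TS.IsPostStar δ I Reach) where
  open TS δ
  open TransitionSystem δ

  reach-induction : ∀ {K : Fin n → Set} → (∀ {x} → x ∈ I → K x) → Closed K →
                    ∀ {y} → y ∈ Reach → K y
  reach-induction {K} base closed {y} y∈ with Equivalence.to (reach y) y∈
  ... | k , y∈postᵏ = go k y∈postᵏ
    where
    go : ∀ k {y} → y ∈ postN k I → K y
    go ℕ.zero y∈I = base y∈I
    go (ℕ.suc k) y∈ with ∈-post⁻ y∈
    ... | x , a , x∈ , x⟶y = closed (go k x∈) x⟶y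

  post-Reach : ∀ {σ} → σ ⊆ Reach → post σ ⊆ Reach
  post-Reach σ⊆Reach y∈ with ∈-post⁻ y∈
  ... | x , a , x∈σ , x⟶y with Equivalence.to (reach x) (σ⊆Reach x∈σ)
  ... | k , x∈postᵏ = Equivalence.from (reach _) (ℕ.suc k , ∈-post⁺ x∈postᵏ x⟶y)

module Exactness {n m : ℕ} (δ : Fin m → Fin n → Subset n) (Reach : Subset n) (Ri Rsim : Rel n)
  (Ri-preorder : IsPreorder Ri) (greatest : TS.IsGreatestSimulation δ Ri Rsim) where
  open TS δ
  open TransitionSystem δ
  open GreatestSimulation δ Ri Rsim Ri-preorder greatest

  Represented : Rel n → Subset n → Fin n → Set
  Represented R σ x = ∃ λ s → s ∈ σ × R x ≡ R s

  record Exact (R : Rel n) (σ : Subset n) : Set where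
    field
      σ⊆Reach     : σ ⊆ Reach
      exact       : ∀ {x} → Represented R σ x → R x ≡ Rsim x
      represented : ∀ {y} → y ∈ Reach → Represented R σ y

  module Output {R : Rel n} {σ : Subset n} (out : Exact R σ) where
    open Exact out
    open ≡-Reasoning

    Psim P : Rel n
    Psim = eqBlock Rsim
    P = sameImage R

    R≡Rsim-on-Reach : ∀ {y} → y ∈ Reach → R y ≡ Rsim y
    R≡Rsim-on-Reach y∈ = exact (represented y∈)

    Psim≡sameImage : ∀ x → Psim x ≡ sameImage Rsim x
    Psim≡sameImage = eqBlock≡sameImage Rsim-refl Rsim-trans

    ∈-Psim⁺ : ∀ {x z} → Rsim z ≡ Rsim x → z ∈ Psim x
    ∈-Psim⁺ {x} eq = subst (_ ∈_) (sym (Psim≡sameImage x)) (∈-sameImage⁺ eq)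

    Psim-cong : ∀ {x y} → Rsim x ≡ Rsim y → Psim x ≡ Psim y
    Psim-cong {x} {y} eq = begin
      Psim x            ≡⟨ Psim≡sameImage x ⟩
      sameImage Rsim x  ≡⟨ sameImage-cong eq ⟩
      sameImage Rsim y  ≡⟨ sym (Psim≡sameImage y) ⟩
      Psim y            ∎

    Psim-at-member : ∀ {B x z} → B ≡ Psim x → z ∈ B → B ≡ Psim z
    Psim-at-member {B} {x} B≡ z∈B =
      trans B≡ (Psim-cong (sym (∈-sameImage⁻ (subst (_ ∈_) (trans B≡ (Psim≡sameImage x)) z∈B))))

    Psim∩Reach≡P∩Reach : ∀ {z} → z ∈ Reach → Psim z ∩ Reach ≡ P z ∩ Reach
    Psim∩Reach≡P∩Reach {z} z∈ = begin
      Psim z ∩ Reach            ≡⟨ cong (_∩ Reach) (Psim≡sameImage z) ⟩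
      sameImage Rsim z ∩ Reach  ≡⟨ sameImage-∩-agree (λ y∈ → sym (R≡Rsim-on-Reach y∈)) z∈ ⟩
      P z ∩ Reach               ∎

    blocksOf-P : ∀ {z} → Represented R σ z → blocksOf Psim (P z) ≡ Psim z
    blocksOf-P {z} rep@(s , s∈σ , Rz≡Rs) =
      ⊆-antisym covered (λ y∈ → ∈-tabulate⁺ inBlockOfPz (z , ∈-sameImage⁺ refl , y∈))
      where
      inBlockOfPz : ∀ y → Dec (∃ λ x → x ∈ P z × y ∈ Psim x)
      inBlockOfPz y = any? (λ x → (x ∈? P z) ×-dec (y ∈? Psim x))
      covered : blocksOf Psim (P z) ⊆ Psim z
      covered {y} y∈ with ∈-tabulate⁻ inBlockOfPz y∈
      ... | x , x∈Pz , y∈Psimx = subst (y ∈_) (Psim-cong Rsimx≡Rsimz) y∈Psimx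
        where
        Rx≡Rz : R x ≡ R z
        Rx≡Rz = ∈-sameImage⁻ x∈Pz
        Rsimx≡Rsimz : Rsim x ≡ Rsim z
        Rsimx≡Rsimz = begin
          Rsim x  ≡⟨ sym (exact (s , s∈σ , trans Rx≡Rz Rz≡Rs)) ⟩
          R x     ≡⟨ Rx≡Rz ⟩
          R z     ≡⟨ exact rep ⟩
          Rsim z  ∎

    P-meets-σ : ∀ {z} → z ∈ Reach → Meeting P σ (P z)
    P-meets-σ {z} z∈ with represented z∈
    ... | s , s∈σ , Rz≡Rs = (z , refl) , s , x∈p∩q⁺ (∈-sameImage⁺ (sym Rz≡Rs) , s∈σ)

    Psim-meets-Reach : ∀ {s} → s ∈ σ → Meeting Psim Reach (Psim s)
    Psim-meets-Reach {s} s∈σ = (s , refl) , s , x∈p∩q⁺ (∈-Psim⁺ refl , σ⊆Reach s∈σ)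

    Rsim-images≐R-images : (λ B → ∃ λ x → x ∈ Reach × B ≡ Rsim x) ≐ (λ B → ∃ λ x → x ∈ σ × B ≡ R x)
    Rsim-images≐R-images B = mk⇔ to from
      where
      to : (∃ λ x → x ∈ Reach × B ≡ Rsim x) → ∃ λ x → x ∈ σ × B ≡ R x
      to (x , x∈ , B≡) with represented x∈
      ... | rep@(s , s∈σ , Rx≡Rs) = s , s∈σ , (begin
        B       ≡⟨ B≡ ⟩
        Rsim x  ≡⟨ sym (exact rep) ⟩
        R x     ≡⟨ Rx≡Rs ⟩
        R s     ∎)
      from : (∃ λ x → x ∈ σ × B ≡ R x) → ∃ λ x → x ∈ Reach × B ≡ Rsim x
      from (s , s∈σ , B≡) = s , σ⊆Reach s∈σ , trans B≡ (exact (s , s∈σ , refl))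

    Psim-traces≐P-traces : (λ C → ∃ λ B → Meeting Psim Reach B × C ≡ B ∩ Reach)
                         ≐ (λ C → ∃ λ B → Meeting P σ B × C ≡ B ∩ Reach)
    Psim-traces≐P-traces C = mk⇔ to from
      where
      to : (∃ λ B → Meeting Psim Reach B × C ≡ B ∩ Reach) → ∃ λ B → Meeting P σ B × C ≡ B ∩ Reach
      to (B , ((x , B≡) , z , z∈) , C≡) with x∈p∩q⁻ B Reach z∈
      ... | z∈B , z∈Reach = P z , P-meets-σ z∈Reach , (begin
        C               ≡⟨ C≡ ⟩
        B ∩ Reach       ≡⟨ cong (_∩ Reach) (Psim-at-member B≡ z∈B) ⟩
        Psim z ∩ Reach  ≡⟨ Psim∩Reach≡P∩Reach z∈Reach ⟩
        P z ∩ Reach     ∎)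
      from : (∃ λ B → Meeting P σ B × C ≡ B ∩ Reach) → ∃ λ B → Meeting Psim Reach B × C ≡ B ∩ Reach
      from (B , ((x , B≡) , s , s∈) , C≡) with x∈p∩q⁻ B σ s∈
      ... | s∈B , s∈σ = Psim s , Psim-meets-Reach s∈σ , (begin
        C               ≡⟨ C≡ ⟩
        B ∩ Reach       ≡⟨ cong (_∩ Reach) (sameImage-at-member B≡ s∈B) ⟩
        P s ∩ Reach     ≡⟨ sym (Psim∩Reach≡P∩Reach (σ⊆Reach s∈σ)) ⟩
        Psim s ∩ Reach  ∎)

    Psim-blocks≐blocksOf-P-blocks : Meeting Psim Reach ≐ (λ C → ∃ λ B → Meeting P σ B × C ≡ blocksOf Psim B)
    Psim-blocks≐blocksOf-P-blocks C = mk⇔ to from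
      where
      to : Meeting Psim Reach C → ∃ λ B → Meeting P σ B × C ≡ blocksOf Psim B
      to ((x , C≡) , z , z∈) with x∈p∩q⁻ C Reach z∈
      ... | z∈C , z∈Reach = P z , P-meets-σ z∈Reach , (begin
        C                     ≡⟨ Psim-at-member C≡ z∈C ⟩
        Psim z                ≡⟨ sym (blocksOf-P (represented z∈Reach)) ⟩
        blocksOf Psim (P z)   ∎)
      from : (∃ λ B → Meeting P σ B × C ≡ blocksOf Psim B) → Meeting Psim Reach C
      from (B , ((x , B≡) , s , s∈) , C≡) with x∈p∩q⁻ B σ s∈
      ... | s∈B , s∈σ = subst (Meeting Psim Reach) (sym C≡Psims) (Psim-meets-Reach s∈σ)
        where
        C≡Psims : C ≡ Psim s
        C≡Psims = begin
          C                    ≡⟨ C≡ ⟩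
          blocksOf Psim B      ≡⟨ cong (blocksOf Psim) (sameImage-at-member B≡ s∈B) ⟩
          blocksOf Psim (P s)  ≡⟨ blocksOf-P (s , s∈σ , refl) ⟩
          Psim s               ∎

module Algorithm5 {n m : ℕ} (δ : Fin m → Fin n → Subset n) (I Reach : Subset n) (Ri Rsim : Rel n)
  (Ri-preorder : IsPreorder Ri) (reach : TS.IsPostStar δ I Reach)
  (greatest : TS.IsGreatestSimulation δ Ri Rsim) where
  open TS δ
  open TransitionSystem δ
  open GreatestSimulation δ Ri Rsim Ri-preorder greatest
  open Reachability δ I Reach reach
  open Exactness δ Reach Ri Rsim Ri-preorder greatest using (Represented; Exact)

  Represented? : ∀ R σ x → Dec (Represented R σ x)
  Represented? R σ x = any? (λ s → (s ∈? σ) ×-dec ≡-dec Bool._≟_ (R x) (R s))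

  record Invariant (R : Rel n) (σ : Subset n) : Set where
    field
      Rsim⊆R  : ∀ x → Rsim x ⊆ R x
      R⊆Ri    : ∀ x → R x ⊆ Ri x
      I⊆σ     : I ⊆ σ
      σ⊆Reach : σ ⊆ Reach

  open Invariant

  invariant-initial : ∀ {σ} → I ⊆ σ → σ ⊆ Reach → Invariant Ri σ
  invariant-initial I⊆σ σ⊆Reach = record
    { Rsim⊆R = λ x → Rsim⊆Ri x _ ; R⊆Ri = λ x z∈ → z∈ ; I⊆σ = I⊆σ ; σ⊆Reach = σ⊆Reach }

  invariant-refine : ∀ {R σ a x x'} → x' ∈ δ a x → Invariant R σ →
                     Invariant (R [ x ]≔ (R x ∩ pre a (R x'))) σ
  invariant-refine {R} {σ} {a} {x} {x'} x⟶x' inv = record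
    { Rsim⊆R = Rsim⊆-refine x⟶x' (Rsim⊆R inv) ; R⊆Ri = shrunk ; I⊆σ = I⊆σ inv ; σ⊆Reach = σ⊆Reach inv }
    where
    shrunk : ∀ y → (R [ x ]≔ (R x ∩ pre a (R x'))) y ⊆ Ri y
    shrunk y z∈ with ∈-if⁻ (y ≟ x) z∈
    ... | inj₁ (refl , z∈∩) = R⊆Ri inv y (proj₁ (x∈p∩q⁻ (R y) _ z∈∩))
    ... | inj₂ z∈R = R⊆Ri inv y z∈R

  invariant-extend : ∀ {R σ T} → T ⊆ post σ → Invariant R σ → Invariant R (σ ∪ T)
  invariant-extend {R} {σ} {T} T⊆post inv = record
    { Rsim⊆R = Rsim⊆R inv ; R⊆Ri = R⊆Ri inv ; I⊆σ = λ x∈I → p⊆p∪q T (I⊆σ inv x∈I)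
    ; σ⊆Reach = λ x∈ → [ σ⊆Reach inv , (λ x∈T → post-Reach (σ⊆Reach inv) (T⊆post x∈T)) ] (x∈p∪q⁻ σ T x∈) }

  represented⇒meets-σ : ∀ {R σ x} → Invariant R σ → Represented R σ x → Nonempty (R x ∩ σ)
  represented⇒meets-σ inv (s , s∈σ , Rx≡Rs) =
    s , x∈p∩q⁺ (subst (s ∈_) (sym Rx≡Rs) (Rsim⊆R inv s (Rsim-refl s)) , s∈σ)

  stable-closed⇒≡Rsim : ∀ {R σ} → Invariant R σ → (K : Fin n → Set) → (∀ x → Dec (K x)) →
                        Stable R K → Closed K → ∀ {x} → K x → R x ≡ Rsim x
  stable-closed⇒≡Rsim {R} inv K K? stable closed Kx =
    ⊆-antisym (stable-closed⇒⊆Rsim R K K? (Rsim⊆R inv) (R⊆Ri inv) stable closed Kx) (Rsim⊆R inv _)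

  exact-on-return : ∀ {R σ} → Invariant R σ → (∀ x → ¬ InU R σ x) → VEmpty R σ → Exact R σ
  exact-on-return {R} {σ} inv U-empty V-empty = record
    { σ⊆Reach = σ⊆Reach inv
    ; exact = stable-closed⇒≡Rsim inv (Represented R σ) (Represented? R σ) stable closed
    ; represented = reach-induction (λ {x} x∈I → x , I⊆σ inv x∈I , refl) closed }
    where
    stable : Stable R (Represented R σ)
    stable {x} {a} {x'} rep x⟶x' =
      decidable-stable (R x ⊆? pre a (R x')) (λ unstable → V-empty a x x' (rep , x⟶x' , unstable))
    -- a successor x' outside the represented states would lie in U
    closed : Closed (Represented R σ)
    closed {x} {a} {x'} rep x⟶x' with represented⇒meets-σ inv rep
    ... | s , s∈ with x∈p∩q⁻ (R x) σ s∈
    ... | s∈Rx , s∈σ with ∈-pre⁻ (stable rep x⟶x' s∈Rx)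
    ... | s' , s⟶s' , s'∈Rx' with Represented? R σ x'
    ...   | yes rep' = rep'
    ...   | no ¬rep' = contradiction (¬rep' , s' , x∈p∩q⁺ (s'∈Rx' , ∈-post⁺ s∈σ s⟶s')) (U-empty x')

  exact-on-refined : ∀ {R σ} → Invariant R σ → post σ ⊆ σ →
                     (∀ a x x' → ¬ RefEnabled R σ a x x') → Exact R σ
  exact-on-refined {R} {σ} inv post⊆σ done = record
    { σ⊆Reach = σ⊆Reach inv
    ; exact = λ rep → stable-closed⇒≡Rsim inv Meets-σ (λ x → nonempty? (R x ∩ σ)) stable closed
                        (represented⇒meets-σ inv rep)
    ; represented = λ y∈ → _ , reach-induction (I⊆σ inv) σ-closed y∈ , refl }
    where
    σ-closed : Closed (_∈ σ)
    σ-closed x∈σ x⟶x' = post⊆σ (∈-post⁺ x∈σ x⟶x')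
    Meets-σ : Fin n → Set
    Meets-σ x = Nonempty (R x ∩ σ)
    stable : Stable R Meets-σ
    stable {x} {a} {x'} meets x⟶x' =
      decidable-stable (R x ⊆? pre a (R x')) (λ unstable → done a x x' (meets , x⟶x' , unstable))
    closed : Closed Meets-σ
    closed {x} {a} {x'} meets@(z , z∈) x⟶x' with x∈p∩q⁻ (R x) σ z∈
    ... | z∈Rx , z∈σ with ∈-pre⁻ (stable meets x⟶x' z∈Rx)
    ... | z' , z⟶z' , z'∈Rx' = z' , x∈p∩q⁺ (z'∈Rx' , post⊆σ (∈-post⁺ z∈σ z⟶z'))

  mutual
    run-exact : ∀ {R σ Ubad R' σ'} → Invariant R σ → Run R σ Ubad R' σ' → Exact R' σ'
    run-exact inv (search-add {σ = σ} x s _ _ _ s∈post _ run) =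
      run-exact (invariant-extend (λ z∈ → subst (_∈ post σ) (sym (x∈⁅y⁆⇒x≡y s z∈)) s∈post) inv) run
    run-exact inv (search-bad x _ _ _ run)              = run-exact inv run
    run-exact inv (refine a x x' (_ , x⟶x' , _) run)    = run-exact (invariant-refine x⟶x' inv) run
    run-exact inv (expand-return _ _ post⊆σ ref)        = ref-exact inv post⊆σ ref
    run-exact inv (expand _ _ _ run)                    = run-exact (invariant-extend (λ z∈ → z∈) inv) run
    run-exact inv (return U-empty V-empty)              = exact-on-return inv U-empty V-empty

    ref-exact : ∀ {R σ R'} → Invariant R σ → post σ ⊆ σ → RefOut R σ R' → Exact R' σ
    ref-exact inv post⊆σ (ref-done done)                       = exact-on-refined inv post⊆σ done
    ref-exact inv post⊆σ (ref-step a x x' (_ , x⟶x' , _) ref) = ref-exact (invariant-refine x⟶x' inv) post⊆σ ref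

theorem7 : ∀ (n m : ℕ) (δ : Fin m → Fin n → Subset n) (I : Subset n)
    (Ri : Rel n) (σi : Subset n) (Reach : Subset n) (Rsim : Rel n)
    (R : Rel n) (σ : Subset n) →
    let open TS δ in
    IsPreorder Ri →
    IsPostStar I Reach →
    I ⊆ σi → σi ⊆ Reach →
    IsGreatestSimulation Ri Rsim →
    Run Ri σi ⊥ R σ →
    let Psim = eqBlock Rsim
        P = sameImage R
    in ((λ B → ∃ λ x → x ∈ Reach × B ≡ Rsim x)
          ≐ (λ B → ∃ λ x → x ∈ σ × B ≡ R x))
     × ((λ C → ∃ λ B → Meeting Psim Reach B × C ≡ B ∩ Reach)
          ≐ (λ C → ∃ λ B → Meeting P σ B × C ≡ B ∩ Reach))
     × (Meeting Psim Reach
          ≐ (λ C → ∃ λ B → Meeting P σ B × C ≡ blocksOf Psim B))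
theorem7 n m δ I Ri σi Reach Rsim R σ Ri-preorder reach I⊆σi σi⊆Reach greatest run =
  Rsim-images≐R-images , Psim-traces≐P-traces , Psim-blocks≐blocksOf-P-blocks
  where
  open Algorithm5 δ I Reach Ri Rsim Ri-preorder reach greatest
  open Exactness.Output δ Reach Ri Rsim Ri-preorder greatest (run-exact (invariant-initial I⊆σi σi⊆Reach) run)
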